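{- Let $\Gamma,\pi,\breve\Gamma$ and the torsors $[\alpha,\beta]$ be as in the context, and let the group $C=\mathbb Z$ act on these torsors as described there. Then for every $m\in C=\mathbb Z$, all $n_1,n_2\in\mathbb Z$ and every $h\in[(n_1,-\infty),(n_2,-\infty)]$ we have $$m(h)=\tfrac12\,m\,(n_1+n_2-1)(n_1-n_2)+h .$$
   Context: $\Gamma$ is an abelian group with a fixed exact sequence $0\to\mathbb Z\to\Gamma\xrightarrow{\pi}\mathbb Z\to0$; fibres $\pi^{ -1}(n)$ are $\mathbb Z$-torsors via $\ker\pi=\mathbb Z$. Order on $\Gamma$: $\gamma_1>\gamma_2$ iff $\pi(\gamma_1)>\pi(\gamma_2)$, or equal and $\gamma_1-\gamma_2\in\ker\pi$ positive. $\breve\Gamma=\Gamma\sqcup\pi(\Gamma)$, elements of $\pi(\Gamma)$ written $(n,-\infty)$; order: compare $\breve\pi$ first ($\breve\pi=\pi$ on $\Gamma$, $\breve\pi(n,-\infty)=n$), $(n,-\infty)$ below all of $\pi^{ -1}(n)$, order of $\Gamma$ on fibres. Torsors: $A\sim B$ means finite symmetric difference. For $\alpha\ge\beta$, $R_{\alpha,\beta}=\{\gamma\in\Gamma:\alpha>\gamma\ge\beta\}$; $Y$ one point of each nonempty $\pi^{ -1}(n)\cap R_{\alpha,\beta}$; $\tau$ = subsets $A\subset R_{\alpha,\beta}$ with $A\sim(\mathbb Z_{\ge0}+Y)\cap R_{\alpha,\beta}$; $[\alpha,\beta]$ = $\mathbb Z$-torsor of maps $d:\tau\to\mathbb Z$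 with $d(A_2)=d(A_1)+|A_2\setminus A_1|$ for $A_1\subset A_2$, $(a+d)(A)=d(A)+a$ ($=\mathbb Z$ if $R_{\alpha,\beta}=\emptyset$); for $\alpha\le\beta$, $[\alpha,\beta]=[\beta,\alpha]^*$ (same underlying set, opposite action). Action of $C=\mathbb Z$: for $m\in\mathbb Z$ let $m\diamond\gamma=\gamma+m\pi(\gamma)$ for $\gamma\in\Gamma$ (with $m\pi(\gamma)\in\ker\pi=\mathbb Z$) and $m\diamond(n,-\infty)=(n,-\infty)$. This is an order-preserving bijection of $\breve\Gamma$ mapping each $R_{\alpha,\beta}$ onto $R_{m\diamond\alpha,m\diamond\beta}$ and the corresponding families $\tau$ onto each other; it induces $h\mapsto m(h)$, $[\alpha,\beta]\to[m\diamond\alpha,m\diamond\beta]$, $d\mapsto d\circ(m\diamond)^{ -1}$ (the same map on underlying sets when $[\alpha,\beta]=[\beta,\alpha]^*$). Since $m\diamond(n,-\infty)=(n,-\infty)$, $m(\cdot)$ acts on $[(n_1,-\infty),(n_2,-\infty)]$. -}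

module Defs where

open import Level using (0ℓ)
open import Data.Bool using (Bool; true; false)
open import Data.Nat as ℕ using (ℕ)
open import Data.Integer using (ℤ; +_; -_; _+_; _*_; _<_; _≤_; 0ℤ)
open import Data.Integer.Properties as ℤP using ()
open import Data.Product using (Σ; _×_; _,_; proj₁; proj₂; ∃)
open import Data.Sum using (_⊎_; inj₁; inj₂)
open import Data.List using (List; length; map)
open import Data.List.Membership.Propositional using (_∈_)
open import Data.List.Membership.Propositional.Properties using (∈-map⁺)
open import Data.List.Relation.Unary.Unique.Propositional using (Unique)
open import Relation.Nullary using (¬_)
open import Relation.Binary.PropositionalEquality
open import Algebra.Structures using (IsAbelianGroup)

record Ext : Set₁ where
  infixl 6 _⊕_
  field
    Γ      : Set
    _⊕_    : Γ → Γ → Γ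
    𝟘      : Γ
    ⊖_     : Γ → Γ
    isAbelianGroup : IsAbelianGroup _≡_ _⊕_ 𝟘 ⊖_
    ι      : ℤ → Γ
    π      : Γ → ℤ
    ι-hom  : ∀ a b → ι (a + b) ≡ ι a ⊕ ι b
    π-hom  : ∀ x y → π (x ⊕ y) ≡ π x + π y
    ι-inj  : ∀ a b → ι a ≡ ι b → a ≡ b
    πι     : ∀ a → π (ι a) ≡ 0ℤ
    exact  : ∀ γ → π γ ≡ 0ℤ → Σ ℤ λ a → ι a ≡ γ
    π-surj : ∀ n → Σ Γ λ γ → π γ ≡ n

module _ (E : Ext) where
  open Ext E
  open IsAbelianGroup isAbelianGroup using (assoc; comm; identityʳ; inverseʳ; ∙-cong)

  -- Γ̆ = Γ ⊔ π(Γ);  inf n stands for (n , -∞).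

  data Γ̆ : Set where
    el  : Γ → Γ̆
    inf : ℤ → Γ̆

  _<̆_ : Γ̆ → Γ̆ → Set
  el x  <̆ el y  = π x < π y ⊎ (π x ≡ π y × Σ ℕ λ k → y ⊕ (⊖ x) ≡ ι (+ ℕ.suc k))
  el x  <̆ inf n = π x < n
  inf n <̆ el y  = n ≤ π y
  inf n <̆ inf k = n < k

  _≤̆_ : Γ̆ → Γ̆ → Set
  a ≤̆ b = a <̆ b ⊎ a ≡ b

  R : Γ̆ → Γ̆ → Γ → Set
  R α β γ = (el γ <̆ α) × (β ≤̆ el γ)

  Subset : Set
  Subset = Γ → Bool

  _∈ₛ_ : Γ → Subset → Set
  γ ∈ₛ A = A γ ≡ true

  _∼_ : Subset → (Γ → Set) → Set
  A ∼ P = Σ (List Γ) λ L → ∀ γ → ¬ (γ ∈ L) →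
            ((γ ∈ₛ A → P γ) × (P γ → γ ∈ₛ A))

  HasCard : (Γ → Set) → ℕ → Set
  HasCard P k = Σ (List Γ) λ L → Unique L × length L ≡ k ×
                  (∀ γ → (P γ → γ ∈ L) × (γ ∈ L → P γ))

  -- Y given by a choice y n of one point in each nonempty fibre π⁻¹(n) ∩ R
  IsSection : Γ̆ → Γ̆ → (ℤ → Γ) → Set
  IsSection α β y = ∀ n γ → π γ ≡ n → R α β γ → (π (y n) ≡ n × R α β (y n))

  Std : Γ̆ → Γ̆ → (ℤ → Γ) → Γ → Set
  Std α β y γ = R α β γ × Σ ℕ λ k → γ ≡ y (π γ) ⊕ ι (+ k)

  τ : Γ̆ → Γ̆ → Set
  τ α β = Σ Subset λ A → (∀ γ → γ ∈ₛ A → R α β γ) ×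
            Σ (ℤ → Γ) λ y → IsSection α β y × (A ∼ Std α β y)

  _⊆τ_ : ∀ {α β} → τ α β → τ α β → Set
  A₁ ⊆τ A₂ = ∀ γ → γ ∈ₛ proj₁ A₁ → γ ∈ₛ proj₁ A₂

  Diff : Subset → Subset → Γ → Set
  Diff A₂ A₁ γ = (A₂ γ ≡ true) × (A₁ γ ≡ false)

  -- underlying set of the torsor [α,β] (for α ≥ β); for α ≤ β the torsor
  -- [α,β] = [β,α]* has underlying set Tor β α with the opposite action.
  record Tor (α β : Γ̆) : Set where
    field
      d   : τ α β → ℤ
      law : ∀ (A₁ A₂ : τ α β) → A₁ ⊆τ A₂ → ∀ k →
              HasCard (Diff (proj₁ A₂) (proj₁ A₁)) k → d A₂ ≡ d A₁ + + k
  open Tor public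

  shift : ∀ {α β} → ℤ → Tor α β → τ α β → ℤ
  shift a h A = d h A + a

  shift* : ∀ {α β} → ℤ → Tor α β → τ α β → ℤ
  shift* a h A = d h A + (- a)

  _⋄_ : ℤ → Γ → Γ
  m ⋄ γ = γ ⊕ ι (m * π γ)

  _⋄̆_ : ℤ → Γ̆ → Γ̆
  m ⋄̆ el γ  = el (m ⋄ γ)
  m ⋄̆ inf n = inf n

  private
    π⋄ : ∀ m γ → π (m ⋄ γ) ≡ π γ
    π⋄ m γ = trans (π-hom γ _) (trans (cong (λ t → π γ + t) (πι _)) (ℤP.+-identityʳ (π γ)))

    ι0 : ι 0ℤ ≡ 𝟘
    ι0 = begin
        ι 0ℤ                       ≡⟨ sym (identityʳ _) ⟩
        ι 0ℤ ⊕ 𝟘                   ≡⟨ cong (ι 0ℤ ⊕_) (sym (inverseʳ (ι 0ℤ))) ⟩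
        ι 0ℤ ⊕ (ι 0ℤ ⊕ ⊖ ι 0ℤ)     ≡⟨ sym (assoc _ _ _) ⟩
        (ι 0ℤ ⊕ ι 0ℤ) ⊕ ⊖ ι 0ℤ     ≡⟨ cong (_⊕ ⊖ ι 0ℤ) (sym (ι-hom 0ℤ 0ℤ)) ⟩
        ι 0ℤ ⊕ ⊖ ι 0ℤ              ≡⟨ inverseʳ _ ⟩
        𝟘 ∎
      where open ≡-Reasoning

    mm : ∀ m n → m * n + (- m) * n ≡ 0ℤ
    mm m n = trans (cong (λ t → m * n + t) (sym (ℤP.neg-distribˡ-* m n))) (ℤP.+-inverseʳ (m * n))

    inv : ∀ m γ → (- m) ⋄ (m ⋄ γ) ≡ γ
    inv m γ = begin
        (γ ⊕ ι (m * π γ)) ⊕ ι (- m * π (m ⋄ γ)) ≡⟨ cong (λ t → (γ ⊕ ι (m * π γ)) ⊕ ι (- m * t)) (π⋄ m γ) ⟩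
        (γ ⊕ ι (m * π γ)) ⊕ ι (- m * π γ)       ≡⟨ assoc _ _ _ ⟩
        γ ⊕ (ι (m * π γ) ⊕ ι (- m * π γ))       ≡⟨ cong (γ ⊕_) (sym (ι-hom _ _)) ⟩
        γ ⊕ ι (m * π γ + - m * π γ)             ≡⟨ cong (λ t → γ ⊕ ι t) (mm m (π γ)) ⟩
        γ ⊕ ι 0ℤ                                ≡⟨ cong (γ ⊕_) ι0 ⟩
        γ ⊕ 𝟘                                   ≡⟨ identityʳ γ ⟩
        γ ∎
      where open ≡-Reasoning

    Rπ : ∀ n₁ n₂ γ γ' → π γ ≡ π γ' → R (inf n₁) (inf n₂) γ → R (inf n₁) (inf n₂) γ'
    Rπ n₁ n₂ γ γ' e (p , inj₁ q) = subst (_< n₁) e p , inj₁ (subst (n₂ ≤_) e q)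

    ιswap : ∀ z a k → (z ⊕ ι k) ⊕ ι a ≡ (z ⊕ ι a) ⊕ ι k
    ιswap z a k = trans (assoc _ _ _) (trans (cong (z ⊕_) (comm _ _)) (sym (assoc _ _ _)))

    fwd : ∀ m γ z k → m ⋄ γ ≡ z ⊕ ι k → γ ≡ (z ⊕ ι (- m * π γ)) ⊕ ι k
    fwd m γ z k e = begin
        γ                                       ≡⟨ sym (inv m γ) ⟩
        (m ⋄ γ) ⊕ ι (- m * π (m ⋄ γ))           ≡⟨ cong₂ (λ s t → s ⊕ ι (- m * t)) e (π⋄ m γ) ⟩
        (z ⊕ ι k) ⊕ ι (- m * π γ)               ≡⟨ ιswap z _ k ⟩
        (z ⊕ ι (- m * π γ)) ⊕ ι k ∎
      where open ≡-Reasoning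

    bwd : ∀ m γ z k → γ ≡ (z ⊕ ι (- m * π γ)) ⊕ ι k → m ⋄ γ ≡ z ⊕ ι k
    bwd m γ z k e = begin
        γ ⊕ ι (m * π γ)                              ≡⟨ cong (_⊕ ι (m * π γ)) e ⟩
        ((z ⊕ ι (- m * π γ)) ⊕ ι k) ⊕ ι (m * π γ)    ≡⟨ cong (_⊕ ι (m * π γ)) (sym (ιswap z _ k)) ⟩
        ((z ⊕ ι k) ⊕ ι (- m * π γ)) ⊕ ι (m * π γ)    ≡⟨ assoc _ _ _ ⟩
        (z ⊕ ι k) ⊕ (ι (- m * π γ) ⊕ ι (m * π γ))    ≡⟨ cong ((z ⊕ ι k) ⊕_) (sym (ι-hom _ _)) ⟩
        (z ⊕ ι k) ⊕ ι (- m * π γ + m * π γ)          ≡⟨ cong (λ t → (z ⊕ ι k) ⊕ ι t) (trans (ℤP.+-comm (- m * π γ) _) (mm m (π γ))) ⟩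
        (z ⊕ ι k) ⊕ ι 0ℤ                             ≡⟨ cong ((z ⊕ ι k) ⊕_) ι0 ⟩
        (z ⊕ ι k) ⊕ 𝟘                                ≡⟨ identityʳ _ ⟩
        z ⊕ ι k ∎
      where open ≡-Reasoning

  pull : ∀ (m n₁ n₂ : ℤ) → τ (inf n₁) (inf n₂) → τ (inf n₁) (inf n₂)
  pull m n₁ n₂ (A , A⊆R , y , sec , L , agree) =
      (λ γ → A (m ⋄ γ))
    , (λ γ p → Rπ n₁ n₂ _ _ (π⋄ m γ) (A⊆R (m ⋄ γ) p))
    , y'
    , sec'
    , map ((- m) ⋄_) L
    , agree'
    where
      y' : ℤ → Γ
      y' n = y n ⊕ ι (- m * n)

      sec' : IsSection (inf n₁) (inf n₂) y'
      sec' n γ e r with sec n γ e r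
      ... | e' , r' = e'' , Rπ n₁ n₂ _ _ (trans e' (sym e'')) r'
        where
          e'' : π (y' n) ≡ n
          e'' = trans (π-hom _ _) (trans (cong (λ t → π (y n) + t) (πι _))
                  (trans (ℤP.+-identityʳ _) e'))

      agree' : ∀ γ → ¬ (γ ∈ map ((- m) ⋄_) L) →
               ((γ ∈ₛ (λ δ → A (m ⋄ δ)) → Std (inf n₁) (inf n₂) y' γ) ×
                (Std (inf n₁) (inf n₂) y' γ → γ ∈ₛ (λ δ → A (m ⋄ δ))))
      agree' γ γ∉ = to , from
        where
          mγ∉ : ¬ ((m ⋄ γ) ∈ L)
          mγ∉ q = γ∉ (subst (_∈ map ((- m) ⋄_) L) (inv m γ) (∈-map⁺ ((- m) ⋄_) q))
          to : γ ∈ₛ (λ δ → A (m ⋄ δ)) → Std (inf n₁) (inf n₂) y' γ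
          to p with proj₁ (agree (m ⋄ γ) mγ∉) p
          ... | r , k , e = Rπ n₁ n₂ _ _ (π⋄ m γ) r
                          , k , fwd m γ (y (π γ)) (+ k) (trans e (cong (λ t → y t ⊕ ι (+ k)) (π⋄ m γ)))
          from : Std (inf n₁) (inf n₂) y' γ → γ ∈ₛ (λ δ → A (m ⋄ δ))
          from (r , k , e) = proj₂ (agree (m ⋄ γ) mγ∉)
              ( Rπ n₁ n₂ _ _ (sym (π⋄ m γ)) r
              , k , trans (bwd m γ (y (π γ)) (+ k) e) (cong (λ t → y t ⊕ ι (+ k)) (sym (π⋄ m γ))) )

  act : ∀ (m n₁ n₂ : ℤ) → Tor (inf n₁) (inf n₂) → τ (inf n₁) (inf n₂) → ℤ
  act m n₁ n₂ h A = d h (pull m n₁ n₂ A)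

{-# OPTIONS --safe #-}
-- Fix coordinates γ = (π γ, coord γ) on Γ and work in the band R = π⁻¹[lo, hi) with
-- {hi, lo} = {n₁, n₂}. Every A ∈ τ agrees, outside a finite set, with a threshold set
-- T(c) = {γ ∈ R : c (π γ) ≤ coord γ}, and (m⋄)⁻¹ maps T(c) to T(c − m·id). The defect
-- δ A = d((m⋄)⁻¹A) − d A is unchanged when A is changed at a single point, since both
-- terms then move by the same ±1; hence δ A = δ T(c). Lowering c by one on one fibre
-- adds exactly one point to T(c), so d T(c′) − d T(c) = Σ_{lo ≤ n < hi} (c n − c′ n) and
-- δ T(c) = Σ_{lo ≤ n < hi} m n = ½ m (hi + lo − 1)(hi − lo). For n₁ < n₂ the torsor is the
-- dual one, which flips the sign.
module Submission where

open import Defs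
open import Data.Bool using (Bool; true; false; if_then_else_)
open import Data.Bool.Properties using (⇔→≡)
open import Data.Nat as ℕ using (ℕ; zero; suc)
import Data.Nat.Properties as ℕP
import Data.Nat.DivMod as ℕD
open import Data.Integer using (ℤ; +_; -[1+_]; -_; _+_; _-_; _*_; _<_; _≤_; 0ℤ; 1ℤ; ∣_∣; +≤+) renaming (suc to sucℤ)
import Data.Integer.Properties as ℤP
open import Data.Integer.DivMod using (_/ℕ_)
open import Data.Integer.Tactic.RingSolver using (solve-∀)
open import Data.Product using (Σ; _×_; _,_; proj₁; proj₂)
open import Data.Sum using (_⊎_; inj₁; inj₂; [_,_]′)
open import Data.Empty using (⊥-elim)
open import Data.List using (List; []; _∷_; _++_)
open import Data.List.Membership.Propositional using (_∈_; _∉_)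
open import Data.List.Membership.Propositional.Properties using (∈-++⁺ˡ; ∈-++⁺ʳ)
open import Data.List.Relation.Unary.Any using (here; there)
open import Data.List.Relation.Unary.All using ([])
open import Data.List.Relation.Unary.AllPairs using ([]; _∷_)
open import Function.Base using (_∘_; case_of_)
open import Function.Bundles using (_⇔_; mk⇔; Equivalence)
open import Function.Properties.Equivalence using () renaming (refl to ⇔-refl)
open import Data.Product.Function.NonDependent.Propositional using (_×-⇔_)
open import Relation.Nullary using (Dec; yes; no; does)
open import Relation.Nullary.Decidable using (_×-dec_; dec-true; dec-false; does-⇔)
open import Relation.Binary.PropositionalEquality
open import Algebra.Structures using (IsAbelianGroup)
open import Algebra.Bundles using (Group)
open import Level using (0ℓ)

∑ : ℕ → (ℕ → ℤ) → ℤ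
∑ zero    f = 0ℤ
∑ (suc N) f = ∑ N f + f N

∑-cong : ∀ N {f g : ℕ → ℤ} → (∀ i → f i ≡ g i) → ∑ N f ≡ ∑ N g
∑-cong zero    f≗g = refl
∑-cong (suc N) f≗g = cong₂ _+_ (∑-cong N f≗g) (f≗g N)

∑-arithmetic : ∀ m lo N {hi} → hi ≡ lo + + N →
               m * (hi + lo - 1ℤ) * (hi - lo) ≡ ∑ N (λ i → m * (lo + + i)) * + 2
∑-arithmetic m lo zero    refl = empty m lo
  where
    empty : ∀ m lo → m * (lo + 0ℤ + lo - 1ℤ) * (lo + 0ℤ - lo) ≡ 0ℤ * + 2
    empty = solve-∀
∑-arithmetic m lo (suc N) refl = begin
    m * (lo + (1ℤ + + N) + lo - 1ℤ) * (lo + (1ℤ + + N) - lo)      ≡⟨ step m lo (+ N) ⟩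
    m * (lo + + N + lo - 1ℤ) * (lo + + N - lo) + f N * + 2        ≡⟨ cong (_+ f N * + 2) (∑-arithmetic m lo N refl) ⟩
    ∑ N f * + 2 + f N * + 2                                        ≡⟨ ℤP.*-distribʳ-+ (+ 2) (∑ N f) (f N) ⟨
    (∑ N f + f N) * + 2                                            ∎
  where
    open ≡-Reasoning
    f : ℕ → ℤ
    f i = m * (lo + + i)
    step : ∀ m lo n → m * (lo + (1ℤ + n) + lo - 1ℤ) * (lo + (1ℤ + n) - lo)
                    ≡ m * (lo + n + lo - 1ℤ) * (lo + n - lo) + m * (lo + n) * + 2
    step = solve-∀

i*2/ℕ2≡i : ∀ i → (i * + 2) /ℕ 2 ≡ i
i*2/ℕ2≡i (+ n)    = trans (cong (_/ℕ 2) (sym (ℤP.pos-* n 2))) (cong +_ (ℕD.m*n/n≡m n 2))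
i*2/ℕ2≡i -[1+ n ] = negative
  where
    even : suc n ℕ.* 2 ℕ.% 2 ≡ 0
    even = ℕD.m*n%n≡0 (suc n) 2
    negative : (-[1+ n ] * + 2) /ℕ 2 ≡ -[1+ n ]
    negative rewrite even = cong (λ t → - (+ t)) (ℕD.m*n/n≡m (suc n) 2)

half-∑-arithmetic : ∀ m lo N {hi} → hi ≡ lo + + N →
                    (m * (hi + lo - 1ℤ) * (hi - lo)) /ℕ 2 ≡ ∑ N (λ i → m * (lo + + i))
half-∑-arithmetic m lo N hi≡ = trans (cong (_/ℕ 2) (∑-arithmetic m lo N hi≡)) (i*2/ℕ2≡i _)

half-∑-arithmetic⁻ : ∀ m lo N {hi} → hi ≡ lo + + N →
                     (m * (lo + hi - 1ℤ) * (lo - hi)) /ℕ 2 ≡ - ∑ N (λ i → m * (lo + + i))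
half-∑-arithmetic⁻ m lo N {hi} hi≡ = begin
    (m * (lo + hi - 1ℤ) * (lo - hi)) /ℕ 2      ≡⟨ cong (_/ℕ 2) (antisymmetric m lo hi) ⟩
    (- (m * (hi + lo - 1ℤ) * (hi - lo))) /ℕ 2  ≡⟨ cong (λ t → (- t) /ℕ 2) (∑-arithmetic m lo N hi≡) ⟩
    (- (S * + 2)) /ℕ 2                         ≡⟨ cong (_/ℕ 2) (ℤP.neg-distribˡ-* S (+ 2)) ⟩
    (- S * + 2) /ℕ 2                           ≡⟨ i*2/ℕ2≡i (- S) ⟩
    - S                                        ∎
  where
    open ≡-Reasoning
    S = ∑ N (λ i → m * (lo + + i))
    antisymmetric : ∀ m a b → m * (a + b - 1ℤ) * (a - b) ≡ - (m * (b + a - 1ℤ) * (b - a))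
    antisymmetric = solve-∀

≤⇒∃ℕ : ∀ {a b} → a ≤ b → Σ ℕ λ k → b ≡ a + + k
≤⇒∃ℕ {a} {b} a≤b = ∣ a - b ∣ , sym (trans (cong (λ t → a + t) (ℤP.∣-∣-≤ a≤b)) (a+[b-a]≡b a b))
  where
    a+[b-a]≡b : ∀ a b → a + (b - a) ≡ b
    a+[b-a]≡b = solve-∀

i≡j+k⇒j≡i-k : ∀ {i j} k → i ≡ j + k → j ≡ i - k
i≡j+k⇒j≡i-k {j = j} k refl = sym (cancel j k)
  where
    cancel : ∀ j k → j + k - k ≡ j
    cancel = solve-∀

i-j≡k⇒i≡j+k : ∀ {i j k} → i - j ≡ k → i ≡ j + k
i-j≡k⇒i≡j+k {i} {j} refl = sym (restore i j)
  where
    restore : ∀ i j → j + (i - j) ≡ i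
    restore = solve-∀

≤-+⇔-≤ : ∀ {i j} k → (i ≤ j + k) ⇔ (i - k ≤ j)
≤-+⇔-≤ {i} {j} k = mk⇔
    (λ p → subst (i - k ≤_) (cancel j k) (ℤP.+-monoˡ-≤ (- k) p))
    (λ p → subst (_≤ j + k) (restore i k) (ℤP.+-monoˡ-≤ k p))
  where
    cancel : ∀ j k → j + k - k ≡ j
    cancel = solve-∀
    restore : ∀ i k → i - k + k ≡ i
    restore = solve-∀

<-suc-⇔ : ∀ {i j} → i ≢ j → (i < sucℤ j) ⇔ (i < j)
<-suc-⇔ {i} {j} i≢j = mk⇔
    (λ p → ℤP.≤∧≢⇒< (subst (i ≤_) (ℤP.pred-suc j) (ℤP.i<j⇒i≤pred[j] p)) i≢j)
    (λ p → ℤP.<-≤-trans p (ℤP.i≤suc[i] j))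

suc≤⇔≤ : ∀ {i j} → i ≢ j → (sucℤ i ≤ j) ⇔ (i ≤ j)
suc≤⇔≤ i≢j = mk⇔ (ℤP.<⇒≤ ∘ ℤP.suc[i]≤j⇒i<j) (λ i≤j → ℤP.i<j⇒suc[i]≤j (ℤP.≤∧≢⇒< i≤j i≢j))

_[_≔_] : (ℤ → ℤ) → ℤ → ℤ → ℤ → ℤ
(c [ n₀ ≔ v ]) n = if does (n ℤP.≟ n₀) then v else c n

[≔]-≡ : ∀ c {n₀ n} v → n ≡ n₀ → (c [ n₀ ≔ v ]) n ≡ v
[≔]-≡ c {n₀} {n} v n≡n₀ rewrite dec-true (n ℤP.≟ n₀) n≡n₀ = refl

[≔]-≤-⇔ : ∀ c {n₀ n k} v w → (n ≡ n₀ → (v ≤ k ⇔ w ≤ k)) →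
          ((c [ n₀ ≔ v ]) n ≤ k) ⇔ ((c [ n₀ ≔ w ]) n ≤ k)
[≔]-≤-⇔ c {n₀} {n} v w at-n₀ with n ℤP.≟ n₀
... | yes n≡n₀ = at-n₀ n≡n₀
... | no  _    = ⇔-refl

[≔]-self : ∀ {c c′ : ℤ → ℤ} {n₀ n} → (n ≢ n₀ → c n ≡ c′ n) → (c [ n₀ ≔ c′ n₀ ]) n ≡ c′ n
[≔]-self {n₀ = n₀} {n} c≡c′ with n ℤP.≟ n₀
... | yes refl  = refl
... | no  n≢n₀  = c≡c′ n≢n₀

does-true : ∀ {A : Set} (a? : Dec A) → does a? ≡ true → A
does-true (yes a) _  = a
does-true (no _)  ()

module _ (E : Ext) where
  open Ext E
  open IsAbelianGroup isAbelianGroup using (assoc; comm; identityˡ; inverseʳ; isGroup)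

  Γ-group : Group 0ℓ 0ℓ
  Γ-group = record { isGroup = isGroup }

  open import Algebra.Properties.Group Γ-group using (∙-cancelˡ; identityˡ-unique)

  ι-0 : ι 0ℤ ≡ 𝟘
  ι-0 = identityˡ-unique (ι 0ℤ) (ι 0ℤ) (sym (ι-hom 0ℤ 0ℤ))

  section : ℤ → Γ
  section n = proj₁ (π-surj n)

  point : ℤ → ℤ → Γ
  point n k = section n ⊕ ι k

  π-point : ∀ n k → π (point n k) ≡ n
  π-point n k = trans (π-hom _ _) (trans (cong₂ _+_ (proj₂ (π-surj n)) (πι k)) (ℤP.+-identityʳ n))

  point-⊕-ι : ∀ n k j → point n k ⊕ ι j ≡ point n (k + j)
  point-⊕-ι n k j = trans (assoc _ _ _) (cong (section n ⊕_) (sym (ι-hom k j)))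

  point-injectiveʳ : ∀ n {k k′} → point n k ≡ point n k′ → k ≡ k′
  point-injectiveʳ n p = ι-inj _ _ (∙-cancelˡ (section n) _ _ p)

  private
    π-offset : ∀ γ → π (γ ⊕ ⊖ section (π γ)) ≡ 0ℤ
    π-offset γ = begin
      π (γ ⊕ ⊖ σ)     ≡⟨ π-hom γ (⊖ σ) ⟩
      π γ + π (⊖ σ)   ≡⟨ cong (_+ π (⊖ σ)) (proj₂ (π-surj (π γ))) ⟨
      π σ + π (⊖ σ)   ≡⟨ π-hom σ (⊖ σ) ⟨
      π (σ ⊕ ⊖ σ)     ≡⟨ cong π (trans (inverseʳ σ) (sym ι-0)) ⟩
      π (ι 0ℤ)        ≡⟨ πι 0ℤ ⟩
      0ℤ              ∎
      where
        open ≡-Reasoning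
        σ = section (π γ)

  coord : Γ → ℤ
  coord γ = proj₁ (exact _ (π-offset γ))

  point-coord : ∀ γ → point (π γ) (coord γ) ≡ γ
  point-coord γ = begin
      σ ⊕ ι (coord γ)   ≡⟨ cong (σ ⊕_) (proj₂ (exact _ (π-offset γ))) ⟩
      σ ⊕ (γ ⊕ ⊖ σ)     ≡⟨ cong (σ ⊕_) (comm γ (⊖ σ)) ⟩
      σ ⊕ (⊖ σ ⊕ γ)     ≡⟨ assoc σ (⊖ σ) γ ⟨
      (σ ⊕ ⊖ σ) ⊕ γ     ≡⟨ cong (_⊕ γ) (inverseʳ σ) ⟩
      𝟘 ⊕ γ             ≡⟨ identityˡ γ ⟩
      γ                 ∎
    where
      open ≡-Reasoning
      σ = section (π γ)

  coord-point : ∀ n k → coord (point n k) ≡ k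
  coord-point n k = point-injectiveʳ n (trans (cong (λ t → point t (coord (point n k))) (sym (π-point n k))) (point-coord (point n k)))

  ≡-coord : ∀ {γ γ′} → π γ ≡ π γ′ → coord γ ≡ coord γ′ → γ ≡ γ′
  ≡-coord {γ} {γ′} p q = trans (sym (point-coord γ)) (trans (cong₂ point p q) (point-coord γ′))

  _≟Γ_ : (γ γ′ : Γ) → Dec (γ ≡ γ′)
  γ ≟Γ γ′ with π γ ℤP.≟ π γ′ | coord γ ℤP.≟ coord γ′
  ... | yes p  | yes q  = yes (≡-coord p q)
  ... | no π≢  | _      = no (π≢ ∘ cong π)
  ... | yes _  | no c≢  = no (c≢ ∘ cong coord)

  infixr 7 _◇_
  _◇_ : ℤ → Γ → Γ
  _◇_ = _⋄_ E

  π-◇ : ∀ m γ → π (m ◇ γ) ≡ π γ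
  π-◇ m γ = trans (π-hom γ _) (trans (cong (λ t → π γ + t) (πι _)) (ℤP.+-identityʳ (π γ)))

  coord-◇ : ∀ m γ → coord (m ◇ γ) ≡ coord γ + m * π γ
  coord-◇ m γ = begin
      coord (γ ⊕ ι (m * π γ))                      ≡⟨ cong (λ t → coord (t ⊕ ι (m * π γ))) (point-coord γ) ⟨
      coord (point (π γ) (coord γ) ⊕ ι (m * π γ))  ≡⟨ cong coord (point-⊕-ι _ _ _) ⟩
      coord (point (π γ) (coord γ + m * π γ))      ≡⟨ coord-point _ _ ⟩
      coord γ + m * π γ                            ∎
    where open ≡-Reasoning

  ◇-inverseʳ : ∀ m γ → m ◇ ((- m) ◇ γ) ≡ γ
  ◇-inverseʳ m γ = ≡-coord (trans (π-◇ m _) (π-◇ (- m) γ)) (begin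
      coord (m ◇ ((- m) ◇ γ))                        ≡⟨ coord-◇ m _ ⟩
      coord ((- m) ◇ γ) + m * π ((- m) ◇ γ)          ≡⟨ cong₂ (λ a b → a + m * b) (coord-◇ (- m) γ) (π-◇ (- m) γ) ⟩
      coord γ + - m * π γ + m * π γ                  ≡⟨ cancel (coord γ) m (π γ) ⟩
      coord γ                                        ∎)
    where
      open ≡-Reasoning
      cancel : ∀ c m p → c + - m * p + m * p ≡ c
      cancel = solve-∀

  ◇-inverseˡ : ∀ m γ → (- m) ◇ (m ◇ γ) ≡ γ
  ◇-inverseˡ m γ = trans (cong (λ t → (- m) ◇ (t ◇ γ)) (sym (ℤP.neg-involutive m))) (◇-inverseʳ (- m) γ)

  -- Generic in P because A : τ E α β does not determine α and β, so they could not be inferred.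
  ⟦_⟧ : ∀ {P : Subset E → Set} → Σ (Subset E) P → Subset E
  ⟦ A ⟧ = proj₁ A

  ⊆R : ∀ {α β} (A : τ E α β) γ → ⟦ A ⟧ γ ≡ true → R E α β γ
  ⊆R A = proj₁ (proj₂ A)

  _≈_off_ : Subset E → Subset E → Γ → Set
  X ≈ Y off x = ∀ γ → γ ≢ x → X γ ≡ Y γ

  module _ {X Y : Subset E} {x : Γ} (X≈Y : X ≈ Y off x) where
    ≈off-sym : Y ≈ X off x
    ≈off-sym γ γ≢x = sym (X≈Y γ γ≢x)

    ≈off-everywhere : X x ≡ Y x → ∀ γ → X γ ≡ Y γ
    ≈off-everywhere Xx≡Yx γ with γ ≟Γ x
    ... | yes refl = Xx≡Yx
    ... | no  γ≢x  = X≈Y γ γ≢x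

    ≈off-⊆ : Y x ≡ true → ∀ γ → X γ ≡ true → Y γ ≡ true
    ≈off-⊆ Yx γ Xγ with γ ≟Γ x
    ... | yes refl = Yx
    ... | no  γ≢x  = trans (sym (X≈Y γ γ≢x)) Xγ

    ≈off-⊆∪ : ∀ γ → Y γ ≡ true → X γ ≡ true ⊎ γ ≡ x
    ≈off-⊆∪ γ Yγ with γ ≟Γ x
    ... | yes γ≡x = inj₂ γ≡x
    ... | no  γ≢x = inj₁ (trans (X≈Y γ γ≢x) Yγ)

  χ : Bool → ℤ
  χ true  = 1ℤ
  χ false = 0ℤ

  module _ {α β : Γ̆ E} (h : Tor E α β) where
    d-cong : (A B : τ E α β) → (∀ γ → ⟦ A ⟧ γ ≡ ⟦ B ⟧ γ) → d h A ≡ d h B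
    d-cong A B A≗B = trans (law h B A B⊆A 0 no-difference) (ℤP.+-identityʳ (d h B))
      where
        B⊆A : ∀ γ → ⟦ B ⟧ γ ≡ true → ⟦ A ⟧ γ ≡ true
        B⊆A γ Bγ = trans (A≗B γ) Bγ
        no-difference : HasCard E (Diff E ⟦ A ⟧ ⟦ B ⟧) 0
        no-difference = [] , [] , refl , λ γ →
          (λ (Aγ , Bγ) → case trans (sym Aγ) (trans (A≗B γ) Bγ) of λ ()) , λ ()

    d-insert : (A B : τ E α β) (x : Γ) → ⟦ A ⟧ x ≡ false → ⟦ B ⟧ x ≡ true →
               (∀ γ → ⟦ A ⟧ γ ≡ true → ⟦ B ⟧ γ ≡ true) →
               (∀ γ → ⟦ B ⟧ γ ≡ true → ⟦ A ⟧ γ ≡ true ⊎ γ ≡ x) →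
               d h B ≡ d h A + 1ℤ
    d-insert A B x Ax Bx A⊆B B⊆A∪x = law h A B A⊆B 1 (x ∷ [] , [] ∷ [] , refl , λ γ → only-x γ , at-x γ)
      where
        only-x : ∀ γ → Diff E ⟦ B ⟧ ⟦ A ⟧ γ → γ ∈ x ∷ []
        only-x γ (Bγ , Aγ) = [ (λ Aγ′ → case trans (sym Aγ′) Aγ of λ ()) , here ]′ (B⊆A∪x γ Bγ)
        at-x : ∀ γ → γ ∈ x ∷ [] → Diff E ⟦ B ⟧ ⟦ A ⟧ γ
        at-x γ (here refl) = Bx , Ax

    d-at : (A B : τ E α β) (x : Γ) → ⟦ A ⟧ ≈ ⟦ B ⟧ off x →
           d h B ≡ d h A + (χ (⟦ B ⟧ x) - χ (⟦ A ⟧ x))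
    d-at A B x A≈B with ⟦ A ⟧ x in Ax | ⟦ B ⟧ x in Bx
    ... | false | false = trans (d-cong B A (sym ∘ ≈off-everywhere A≈B (trans Ax (sym Bx)))) (sym (ℤP.+-identityʳ _))
    ... | true  | true  = trans (d-cong B A (sym ∘ ≈off-everywhere A≈B (trans Ax (sym Bx)))) (sym (ℤP.+-identityʳ _))
    ... | false | true  = d-insert A B x Ax Bx (≈off-⊆ A≈B Bx) (≈off-⊆∪ A≈B)
    ... | true  | false = i≡j+k⇒j≡i-k 1ℤ
                            (d-insert B A x Bx Ax (≈off-⊆ (≈off-sym A≈B) Ax) (≈off-⊆∪ (≈off-sym A≈B)))

  modify : ∀ {α β} (A : τ E α β) (X : Subset E) (L : List Γ) →
           (∀ γ → X γ ≡ true → R E α β γ) → (∀ γ → γ ∉ L → X γ ≡ ⟦ A ⟧ γ) → τ E α β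
  modify {α} {β} (_ , _ , y , isSection , L′ , A∼Std) X L X⊆R X≈A =
      X , X⊆R , y , isSection , L ++ L′ , X∼Std
    where
      X∼Std : ∀ γ → γ ∉ L ++ L′ → (X γ ≡ true → Std E α β y γ) × (Std E α β y γ → X γ ≡ true)
      X∼Std γ γ∉ =
          (λ Xγ → proj₁ (A∼Std γ γ∉L′) (trans (sym X≡A) Xγ))
        , (λ std → trans X≡A (proj₂ (A∼Std γ γ∉L′) std))
        where
          X≡A = X≈A γ (γ∉ ∘ ∈-++⁺ˡ)
          γ∉L′ = γ∉ ∘ ∈-++⁺ʳ L

  module _ (X Y : Subset E) where
    patch : List Γ → Subset E
    patch []      γ = Y γ
    patch (x ∷ L) γ = if does (γ ≟Γ x) then X γ else patch L γ

    patch-∉ : ∀ L {γ} → γ ∉ L → patch L γ ≡ Y γ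
    patch-∉ []          _  = refl
    patch-∉ (x ∷ L) {γ} γ∉ with γ ≟Γ x
    ... | yes γ≡x = ⊥-elim (γ∉ (here γ≡x))
    ... | no  _   = patch-∉ L (γ∉ ∘ there)

    patch-≡ : ∀ L {γ} → (γ ∉ L → X γ ≡ Y γ) → patch L γ ≡ X γ
    patch-≡ []          X≡Y = sym (X≡Y λ ())
    patch-≡ (x ∷ L) {γ} X≡Y with γ ≟Γ x
    ... | yes _   = refl
    ... | no  γ≢x = patch-≡ L (λ γ∉L → X≡Y λ { (here γ≡x) → γ≢x γ≡x ; (there γ∈L) → γ∉L γ∈L })

    patch-∷ : ∀ L x → patch L ≈ patch (x ∷ L) off x
    patch-∷ L x γ γ≢x with γ ≟Γ x
    ... | yes γ≡x = ⊥-elim (γ≢x γ≡x)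
    ... | no  _   = refl

    patch-⊆ : ∀ L γ → patch L γ ≡ true → X γ ≡ true ⊎ Y γ ≡ true
    patch-⊆ []      γ p = inj₂ p
    patch-⊆ (x ∷ L) γ p with γ ≟Γ x
    ... | yes _ = inj₁ p
    ... | no  _ = patch-⊆ L γ p

  module Band (hi lo : ℤ) where
    𝒜 : Set
    𝒜 = τ E (inf hi) (inf lo)

    InRange : ℤ → Set
    InRange n = n < hi × lo ≤ n

    inRange? : ∀ n → Dec (InRange n)
    inRange? n = (n ℤP.<? hi) ×-dec (lo ℤP.≤? n)

    R⇒InRange : ∀ {γ} → R E (inf hi) (inf lo) γ → InRange (π γ)
    R⇒InRange (π<hi , inj₁ lo≤π) = π<hi , lo≤π

    InRange⇒R : ∀ γ → InRange (π γ) → R E (inf hi) (inf lo) γ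
    InRange⇒R _ (π<hi , lo≤π) = π<hi , inj₁ lo≤π

    Above : (ℤ → ℤ) → Γ → Set
    Above c γ = InRange (π γ) × c (π γ) ≤ coord γ

    above? : ∀ c γ → Dec (Above c γ)
    above? c γ = inRange? (π γ) ×-dec (c (π γ) ℤP.≤? coord γ)

    threshold : (ℤ → ℤ) → Subset E
    threshold c γ = does (above? c γ)

    threshold-sound : ∀ c γ → threshold c γ ≡ true → Above c γ
    threshold-sound c γ = does-true (above? c γ)

    threshold-complete : ∀ c γ → Above c γ → threshold c γ ≡ true
    threshold-complete c γ = dec-true (above? c γ)

    threshold-⇔ : ∀ {c c′ γ γ′} → Above c γ ⇔ Above c′ γ′ → threshold c γ ≡ threshold c′ γ′
    threshold-⇔ {c} {c′} {γ} {γ′} eq = does-⇔ eq (above? c γ) (above? c′ γ′)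

    threshold-cong : ∀ {c c′} → (∀ n → InRange n → c n ≡ c′ n) → ∀ γ → threshold c γ ≡ threshold c′ γ
    threshold-cong {c} {c′} c≗c′ γ = threshold-⇔ {c} {c′} (mk⇔
      (λ (n∈ , c≤) → n∈ , subst (_≤ coord γ) (c≗c′ _ n∈) c≤)
      (λ (n∈ , c′≤) → n∈ , subst (_≤ coord γ) (sym (c≗c′ _ n∈)) c′≤))

    Std⇔Above : (y : ℤ → Γ) (c : ℤ → ℤ) → (∀ n → InRange n → y n ≡ point n (c n)) →
                ∀ γ → Std E (inf hi) (inf lo) y γ ⇔ Above c γ
    Std⇔Above y c y≡point γ = mk⇔ to from
      where
        open ≡-Reasoning
        to : Std E (inf hi) (inf lo) y γ → Above c γ
        to (r , k , γ≡) = R⇒InRange r , subst (c (π γ) ≤_) (sym coord≡) (ℤP.i≤i+j (c (π γ)) (+ k))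
          where
            coord≡ : coord γ ≡ c (π γ) + + k
            coord≡ = begin
              coord γ                                  ≡⟨ cong coord γ≡ ⟩
              coord (y (π γ) ⊕ ι (+ k))                ≡⟨ cong (λ z → coord (z ⊕ ι (+ k))) (y≡point _ (R⇒InRange r)) ⟩
              coord (point (π γ) (c (π γ)) ⊕ ι (+ k))  ≡⟨ cong coord (point-⊕-ι _ _ _) ⟩
              coord (point (π γ) (c (π γ) + + k))      ≡⟨ coord-point _ _ ⟩
              c (π γ) + + k                            ∎
        from : Above c γ → Std E (inf hi) (inf lo) y γ
        from (π∈ , c≤) = InRange⇒R γ π∈ , k , γ≡
          where
            k = proj₁ (≤⇒∃ℕ c≤)
            γ≡ : γ ≡ y (π γ) ⊕ ι (+ k)
            γ≡ = begin
              γ                                ≡⟨ point-coord γ ⟨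
              point (π γ) (coord γ)            ≡⟨ cong (point (π γ)) (proj₂ (≤⇒∃ℕ c≤)) ⟩
              point (π γ) (c (π γ) + + k)      ≡⟨ point-⊕-ι _ _ _ ⟨
              point (π γ) (c (π γ)) ⊕ ι (+ k)  ≡⟨ cong (_⊕ ι (+ k)) (y≡point _ π∈) ⟨
              y (π γ) ⊕ ι (+ k)                ∎

    thresholdτ : (ℤ → ℤ) → 𝒜
    thresholdτ c = threshold c , (λ γ → InRange⇒R γ ∘ proj₁ ∘ threshold-sound c γ) , y , isSection , [] , agree
      where
        y : ℤ → Γ
        y n = point n (c n)
        isSection : IsSection E (inf hi) (inf lo) y
        isSection n γ refl r = π-point _ _ , InRange⇒R (y n) (subst InRange (sym (π-point _ _)) (R⇒InRange r))
        agree : ∀ γ → γ ∉ [] → (threshold c γ ≡ true → Std E (inf hi) (inf lo) y γ) × (Std E (inf hi) (inf lo) y γ → threshold c γ ≡ true)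
        agree γ _ = Equivalence.from std⇔ ∘ threshold-sound c γ , threshold-complete c γ ∘ Equivalence.to std⇔
          where std⇔ = Std⇔Above y c (λ _ _ → refl) γ

    baseline : 𝒜 → ℤ → ℤ
    baseline (_ , _ , y , _) n = coord (y n)

    ∼threshold : (A : 𝒜) → Σ (List Γ) λ L → ∀ γ → γ ∉ L → ⟦ A ⟧ γ ≡ threshold (baseline A) γ
    ∼threshold A@(X , _ , y , isSection , L , X∼Std) = L , X≡threshold
      where
        π[y]≡ : ∀ n → InRange n → π (y n) ≡ n
        π[y]≡ n n∈ = proj₁ (isSection n (point n 0ℤ) (π-point n 0ℤ) (InRange⇒R (point n 0ℤ) (subst InRange (sym (π-point n 0ℤ)) n∈)))
        y≡point : ∀ n → InRange n → y n ≡ point n (coord (y n))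
        y≡point n n∈ = trans (sym (point-coord (y n))) (cong (λ t → point t (coord (y n))) (π[y]≡ n n∈))
        X≡threshold : ∀ γ → γ ∉ L → X γ ≡ threshold (baseline A) γ
        X≡threshold γ γ∉L = ⇔→≡ {z = true} (mk⇔
            (threshold-complete (baseline A) γ ∘ Equivalence.to std⇔ ∘ proj₁ (X∼Std γ γ∉L))
            (proj₂ (X∼Std γ γ∉L) ∘ Equivalence.from std⇔ ∘ threshold-sound (baseline A) γ))
          where
            std⇔ : Std E (inf hi) (inf lo) y γ ⇔ Above (baseline A) γ
            std⇔ = Std⇔Above y (baseline A) y≡point γ

    pull-threshold : ∀ m c γ → ⟦ pull E m hi lo (thresholdτ c) ⟧ γ ≡ threshold (λ n → c n - m * n) γ
    pull-threshold m c γ = threshold-⇔ {c} {λ n → c n - m * n} {m ◇ γ} {γ} (mk⇔ to from)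
      where
        π≡ : π (m ◇ γ) ≡ π γ
        π≡ = π-◇ m γ
        to : Above c (m ◇ γ) → Above (λ n → c n - m * n) γ
        to (π∈ , c≤) = subst InRange π≡ π∈
                     , Equivalence.to (≤-+⇔-≤ (m * π γ)) (subst₂ _≤_ (cong c π≡) (coord-◇ m γ) c≤)
        from : Above (λ n → c n - m * n) γ → Above c (m ◇ γ)
        from (π∈ , c≤) = subst InRange (sym π≡) π∈
                       , subst₂ _≤_ (cong c (sym π≡)) (sym (coord-◇ m γ)) (Equivalence.from (≤-+⇔-≤ (m * π γ)) c≤)

    module _ (h : Tor E (inf hi) (inf lo)) where
      dT : (ℤ → ℤ) → ℤ
      dT c = d h (thresholdτ c)

      dT-cong : ∀ {c c′} → (∀ n → InRange n → c n ≡ c′ n) → dT c ≡ dT c′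
      dT-cong {c} {c′} c≗c′ = d-cong h (thresholdτ c) (thresholdτ c′) (threshold-cong c≗c′)

      dT-raise : ∀ c {n₀} v → InRange n₀ → dT (c [ n₀ ≔ v ]) ≡ dT (c [ n₀ ≔ sucℤ v ]) + 1ℤ
      dT-raise c {n₀} v n₀∈ = begin
          dT (c [ n₀ ≔ v ])
            ≡⟨ d-at h (thresholdτ (c [ n₀ ≔ sucℤ v ])) (thresholdτ (c [ n₀ ≔ v ])) x off-x ⟩
          dT (c [ n₀ ≔ sucℤ v ]) + (χ (threshold (c [ n₀ ≔ v ]) x) - χ (threshold (c [ n₀ ≔ sucℤ v ]) x))
            ≡⟨ cong₂ (λ a b → dT (c [ n₀ ≔ sucℤ v ]) + (χ a - χ b)) x-above x-not-above ⟩
          dT (c [ n₀ ≔ sucℤ v ]) + 1ℤ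
            ∎
        where
          open ≡-Reasoning
          x : Γ
          x = point n₀ v
          x-above : threshold (c [ n₀ ≔ v ]) x ≡ true
          x-above = threshold-complete (c [ n₀ ≔ v ]) x
            ( subst InRange (sym (π-point n₀ v)) n₀∈
            , ℤP.≤-reflexive (trans ([≔]-≡ c v (π-point n₀ v)) (sym (coord-point n₀ v))) )
          x-not-above : threshold (c [ n₀ ≔ sucℤ v ]) x ≡ false
          x-not-above = dec-false (above? (c [ n₀ ≔ sucℤ v ]) x) λ (_ , suc≤) →
            ℤP.<-irrefl refl (ℤP.suc[i]≤j⇒i<j (subst₂ _≤_ ([≔]-≡ c (sucℤ v) (π-point n₀ v)) (coord-point n₀ v) suc≤))
          off-x : threshold (c [ n₀ ≔ sucℤ v ]) ≈ threshold (c [ n₀ ≔ v ]) off x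
          off-x γ γ≢x = threshold-⇔ {c [ n₀ ≔ sucℤ v ]} {c [ n₀ ≔ v ]} {γ} {γ}
            (⇔-refl ×-⇔ [≔]-≤-⇔ c (sucℤ v) v λ πγ≡n₀ →
              suc≤⇔≤ λ v≡coord → γ≢x (≡-coord (trans πγ≡n₀ (sym (π-point n₀ v)))
                                               (trans (sym v≡coord) (sym (coord-point n₀ v)))))

      dT-raise-by : ∀ c {n₀} v k → InRange n₀ → dT (c [ n₀ ≔ v ]) ≡ dT (c [ n₀ ≔ + k + v ]) + + k
      dT-raise-by c {n₀} v zero    n₀∈ =
        trans (cong (λ w → dT (c [ n₀ ≔ w ])) (sym (ℤP.+-identityˡ v))) (sym (ℤP.+-identityʳ _))
      dT-raise-by c {n₀} v (suc k) n₀∈ = begin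
          dT (c [ n₀ ≔ v ])                             ≡⟨ dT-raise-by c v k n₀∈ ⟩
          dT (c [ n₀ ≔ + k + v ]) + + k                 ≡⟨ cong (_+ + k) (dT-raise c (+ k + v) n₀∈) ⟩
          dT (c [ n₀ ≔ sucℤ (+ k + v) ]) + 1ℤ + + k     ≡⟨ ℤP.+-assoc (dT (c [ n₀ ≔ sucℤ (+ k + v) ])) 1ℤ (+ k) ⟩
          dT (c [ n₀ ≔ sucℤ (+ k + v) ]) + + suc k      ≡⟨ cong (λ w → dT (c [ n₀ ≔ w ]) + + suc k) (sym (ℤP.+-assoc 1ℤ (+ k) v)) ⟩
          dT (c [ n₀ ≔ + suc k + v ]) + + suc k         ∎
        where open ≡-Reasoning

      dT-fibre : ∀ c {n₀} v w → InRange n₀ → dT (c [ n₀ ≔ w ]) ≡ dT (c [ n₀ ≔ v ]) + (v - w)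
      dT-fibre c {n₀} v w n₀∈ = [ lower v w , higher ]′ (ℤP.≤-total w v)
        where
          lower : ∀ v w → w ≤ v → dT (c [ n₀ ≔ w ]) ≡ dT (c [ n₀ ≔ v ]) + (v - w)
          lower v w w≤v with ≤⇒∃ℕ w≤v
          ... | k , refl = trans (dT-raise-by c w k n₀∈)
                                 (cong₂ (λ a b → dT (c [ n₀ ≔ a ]) + b) (ℤP.+-comm (+ k) w) (k≡ w (+ k)))
            where
              k≡ : ∀ w k → k ≡ w + k - w
              k≡ = solve-∀
          higher : v ≤ w → dT (c [ n₀ ≔ w ]) ≡ dT (c [ n₀ ≔ v ]) + (v - w)
          higher v≤w = trans (i≡j+k⇒j≡i-k (w - v) (lower w v v≤w)) (flip-sign (dT (c [ n₀ ≔ v ])) v w)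
            where
              flip-sign : ∀ a v w → a - (w - v) ≡ a + (v - w)
              flip-sign = solve-∀

      dT-single : ∀ {c c′ n₀} → InRange n₀ → (∀ n → InRange n → n ≢ n₀ → c n ≡ c′ n) →
                  dT c′ ≡ dT c + (c n₀ - c′ n₀)
      dT-single {c} {c′} {n₀} n₀∈ c≡c′ = begin
          dT c′                                        ≡⟨ dT-cong (λ n n∈ → sym ([≔]-self {c} {c′} (c≡c′ n n∈))) ⟩
          dT (c [ n₀ ≔ c′ n₀ ])                        ≡⟨ dT-fibre c (c n₀) (c′ n₀) n₀∈ ⟩
          dT (c [ n₀ ≔ c n₀ ]) + (c n₀ - c′ n₀)        ≡⟨ cong (_+ (c n₀ - c′ n₀)) (dT-cong {c [ n₀ ≔ c n₀ ]} {c} (λ n _ → [≔]-self {c} {c} λ _ → refl)) ⟩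
          dT c + (c n₀ - c′ n₀)                        ∎
        where open ≡-Reasoning

      dT-telescope : ∀ N → hi ≡ lo + + N → ∀ c c′ →
                     dT c′ ≡ dT c + ∑ N (λ i → c (lo + + i) - c′ (lo + + i))
      dT-telescope N hi≡ c c′ = trans (dT-cong all-c′) (partial N ℕP.≤-refl)
        where
          open ≡-Reasoning
          mix : ℕ → ℤ → ℤ
          mix j n = if does (n ℤP.<? lo + + j) then c′ n else c n
          dif : ℕ → ℤ
          dif i = c (lo + + i) - c′ (lo + + i)
          all-c′ : ∀ n → InRange n → c′ n ≡ mix N n
          all-c′ n (n<hi , _) = cong (λ b → if b then c′ n else c n)
                                     (sym (dec-true (n ℤP.<? lo + + N) (subst (n <_) hi≡ n<hi)))
          partial : ∀ j → j ℕ.≤ N → dT (mix j) ≡ dT c + ∑ j dif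
          partial zero _ = trans (dT-cong none-c′) (sym (ℤP.+-identityʳ (dT c)))
            where
              none-c′ : ∀ n → InRange n → mix zero n ≡ c n
              none-c′ n (_ , lo≤n) = cong (λ b → if b then c′ n else c n)
                (dec-false (n ℤP.<? lo + 0ℤ) (ℤP.≤⇒≯ (subst (_≤ n) (sym (ℤP.+-identityʳ lo)) lo≤n)))
          partial (suc j) sj≤N = begin
              dT (mix (suc j))                          ≡⟨ dT-single n₀∈ (λ n _ → mix-off n) ⟩
              dT (mix j) + (mix j n₀ - mix (suc j) n₀)  ≡⟨ cong₂ (λ a b → dT (mix j) + (a - b)) mix-j-n₀ mix-sj-n₀ ⟩
              dT (mix j) + dif j                        ≡⟨ cong (_+ dif j) (partial j (ℕP.<⇒≤ sj≤N)) ⟩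
              dT c + ∑ j dif + dif j                    ≡⟨ ℤP.+-assoc (dT c) (∑ j dif) (dif j) ⟩
              dT c + ∑ (suc j) dif                      ∎
            where
              n₀ : ℤ
              n₀ = lo + + j
              next≡ : lo + + suc j ≡ sucℤ n₀
              next≡ = shift-one lo (+ j)
                where
                  shift-one : ∀ lo t → lo + (1ℤ + t) ≡ 1ℤ + (lo + t)
                  shift-one = solve-∀
              n₀<next : n₀ < lo + + suc j
              n₀<next = subst (n₀ <_) (sym next≡) (ℤP.suc[i]≤j⇒i<j ℤP.≤-refl)
              n₀∈ : InRange n₀
              n₀∈ = ℤP.<-≤-trans n₀<next (subst (lo + + suc j ≤_) (sym hi≡) (ℤP.+-monoʳ-≤ lo (+≤+ sj≤N)))
                  , ℤP.i≤i+j lo (+ j)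
              mix-off : ∀ n → n ≢ n₀ → mix j n ≡ mix (suc j) n
              mix-off n n≢n₀ = cong (λ b → if b then c′ n else c n) (does-⇔ below⇔ (n ℤP.<? n₀) (n ℤP.<? lo + + suc j))
                where
                  below⇔ : (n < n₀) ⇔ (n < lo + + suc j)
                  below⇔ = mk⇔ (subst (n <_) (sym next≡) ∘ Equivalence.from (<-suc-⇔ n≢n₀))
                               (Equivalence.to (<-suc-⇔ n≢n₀) ∘ subst (n <_) next≡)
              mix-j-n₀ : mix j n₀ ≡ c n₀
              mix-j-n₀ = cong (λ b → if b then c′ n₀ else c n₀) (dec-false (n₀ ℤP.<? n₀) (ℤP.<-irrefl refl))
              mix-sj-n₀ : mix (suc j) n₀ ≡ c′ n₀
              mix-sj-n₀ = cong (λ b → if b then c′ n₀ else c n₀) (dec-true (n₀ ℤP.<? lo + + suc j) n₀<next)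

      module _ (m : ℤ) where
        δ : 𝒜 → ℤ
        δ A = d h (pull E m hi lo A) - d h A

        δ-cong : (A B : 𝒜) → (∀ γ → ⟦ A ⟧ γ ≡ ⟦ B ⟧ γ) → δ A ≡ δ B
        δ-cong A B A≗B = cong₂ _-_ (d-cong h (pull E m hi lo A) (pull E m hi lo B) (λ γ → A≗B (m ◇ γ)))
                                   (d-cong h A B A≗B)

        -- d (pull A) and d (pull B) differ at the single point (- m) ◇ x, by the same amount as d A and d B.
        δ-at : (A B : 𝒜) (x : Γ) → ⟦ A ⟧ ≈ ⟦ B ⟧ off x → δ A ≡ δ B
        δ-at A B x A≈B = begin
            d h PA - d h A              ≡⟨ cancel (d h PA) (d h A) k ⟨
            (d h PA + k) - (d h A + k)  ≡⟨ cong₂ _-_ dPB (d-at h A B x A≈B) ⟨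
            d h PB - d h B              ∎
          where
            open ≡-Reasoning
            PA = pull E m hi lo A
            PB = pull E m hi lo B
            k = χ (⟦ B ⟧ x) - χ (⟦ A ⟧ x)
            cancel : ∀ a b k → (a + k) - (b + k) ≡ a - b
            cancel = solve-∀
            PA≈PB : ⟦ PA ⟧ ≈ ⟦ PB ⟧ off ((- m) ◇ x)
            PA≈PB γ γ≢ = A≈B (m ◇ γ) λ mγ≡x → γ≢ (trans (sym (◇-inverseˡ m γ)) (cong ((- m) ◇_) mγ≡x))
            dPB : d h PB ≡ d h PA + k
            dPB = trans (d-at h PA PB ((- m) ◇ x) PA≈PB)
                        (cong (λ z → d h PA + (χ (⟦ B ⟧ z) - χ (⟦ A ⟧ z))) (◇-inverseʳ m x))

        δ-finite : (A B : 𝒜) (L : List Γ) → (∀ γ → γ ∉ L → ⟦ A ⟧ γ ≡ ⟦ B ⟧ γ) → δ A ≡ δ B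
        δ-finite A B L A≡B = trans (δ-cong A (P L) λ γ → sym (patch-≡ ⟦ A ⟧ ⟦ B ⟧ L (A≡B γ))) (towards L)
          where
            P : List Γ → 𝒜
            P K = modify {inf hi} {inf lo} B (patch ⟦ A ⟧ ⟦ B ⟧ K) K
                    (λ γ → [ ⊆R {inf hi} {inf lo} A γ , ⊆R {inf hi} {inf lo} B γ ]′ ∘ patch-⊆ ⟦ A ⟧ ⟦ B ⟧ K γ)
                    (λ γ → patch-∉ ⟦ A ⟧ ⟦ B ⟧ K)
            towards : ∀ K → δ (P K) ≡ δ B
            towards []      = δ-cong (P []) B λ _ → refl
            towards (x ∷ K) = trans (sym (δ-at (P K) (P (x ∷ K)) x (patch-∷ ⟦ A ⟧ ⟦ B ⟧ K x))) (towards K)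

        δ-threshold : ∀ N → hi ≡ lo + + N → ∀ c → δ (thresholdτ c) ≡ ∑ N (λ i → m * (lo + + i))
        δ-threshold N hi≡ c = begin
            d h (pull E m hi lo (thresholdτ c)) - dT c ≡⟨ cong (_- dT c) (d-cong h _ (thresholdτ c′) (pull-threshold m c)) ⟩
            dT c′ - dT c                                ≡⟨ cong (_- dT c) (dT-telescope N hi≡ c c′) ⟩
            dT c + ∑ N dif - dT c                       ≡⟨ cancel (dT c) (∑ N dif) ⟩
            ∑ N dif                                     ≡⟨ ∑-cong N (λ i → shear (c (lo + + i)) m (lo + + i)) ⟩
            ∑ N (λ i → m * (lo + + i))                  ∎
          where
            open ≡-Reasoning
            c′ : ℤ → ℤ
            c′ n = c n - m * n
            dif : ℕ → ℤ
            dif i = c (lo + + i) - c′ (lo + + i)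
            cancel : ∀ a s → a + s - a ≡ s
            cancel = solve-∀
            shear : ∀ a m n → a - (a - m * n) ≡ m * n
            shear = solve-∀

        pull-shift : ∀ N → hi ≡ lo + + N → ∀ A → d h (pull E m hi lo A) ≡ d h A + ∑ N (λ i → m * (lo + + i))
        pull-shift N hi≡ A = i-j≡k⇒i≡j+k (trans (δ-finite A (thresholdτ (baseline A)) L A∼T)
                                                (δ-threshold N hi≡ (baseline A)))
          where
            L = proj₁ (∼threshold A)
            A∼T = proj₂ (∼threshold A)

lemma5 : (E : Ext) (m n₁ n₂ : ℤ) →
    (n₂ ≤ n₁ → (h : Tor E (inf n₁) (inf n₂)) → (A : τ E (inf n₁) (inf n₂)) →
       act E m n₁ n₂ h A ≡ shift E ((m * (n₁ + n₂ - 1ℤ) * (n₁ - n₂)) /ℕ 2) h A)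
    × (n₁ < n₂ → (h : Tor E (inf n₂) (inf n₁)) → (A : τ E (inf n₂) (inf n₁)) →
       act E m n₂ n₁ h A ≡ shift* E ((m * (n₁ + n₂ - 1ℤ) * (n₁ - n₂)) /ℕ 2) h A)
lemma5 E m n₁ n₂ = descending , ascending
  where
    descending : n₂ ≤ n₁ → (h : Tor E (inf n₁) (inf n₂)) → (A : τ E (inf n₁) (inf n₂)) →
                 act E m n₁ n₂ h A ≡ shift E ((m * (n₁ + n₂ - 1ℤ) * (n₁ - n₂)) /ℕ 2) h A
    descending n₂≤n₁ h A =
      let (N , n₁≡) = ≤⇒∃ℕ n₂≤n₁ in
      trans (Band.pull-shift E n₁ n₂ h m N n₁≡ A)
            (cong (λ t → d h A + t) (sym (half-∑-arithmetic m n₂ N n₁≡)))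

    ascending : n₁ < n₂ → (h : Tor E (inf n₂) (inf n₁)) → (A : τ E (inf n₂) (inf n₁)) →
                act E m n₂ n₁ h A ≡ shift* E ((m * (n₁ + n₂ - 1ℤ) * (n₁ - n₂)) /ℕ 2) h A
    ascending n₁<n₂ h A =
      let (N , n₂≡) = ≤⇒∃ℕ (ℤP.<⇒≤ n₁<n₂) in
      trans (Band.pull-shift E n₂ n₁ h m N n₂≡ A)
            (cong (λ t → d h A + t) (sym (trans (cong -_ (half-∑-arithmetic⁻ m n₁ N n₂≡)) (ℤP.neg-involutive _))))
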